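{- Let $G$ be a finite simple undirected graph. Then $G$ is sc-orientable if and only if there is an sc-orientation $\sigma$ of $G$ such that the directed graph $G_\sigma$ contains no directed cycle of length at least $4$.
   Context: A directed graph $D$ is singly connected if for every ordered pair of vertices $(s,t)$ there is at most one directed path from $s$ to $t$ in $D$. For an undirected graph $G$, an $E(G)$-orientation is a map $\sigma$ assigning to each edge $\{u,v\}\in E(G)$ one of its endpoints (the head); $G_\sigma$ is the resulting directed graph, in which $\{u,v\}$ becomes the arc directed towards $\sigma(\{u,v\})$. $\sigma$ is an sc-orientation if $G_\sigma$ is singly connected, and $G$ is sc-orientable if it has an sc-orientation. -}

module Defs where

open import Data.Nat using (ℕ; _≤_)
open import Data.Fin using (Fin)
open import Data.Bool using (Bool; true; false)
open import Data.List using (List; []; _∷_; length)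
open import Data.List.Relation.Unary.Unique.Propositional using (Unique)
open import Data.Product using (Σ; ∃; _×_)
open import Data.Sum using (_⊎_)
open import Relation.Binary.PropositionalEquality using (_≡_)

record SimpleGraph (n : ℕ) : Set where
  field
    Adj    : Fin n → Fin n → Bool
    sym    : ∀ u v → Adj u v ≡ Adj v u
    irrefl : ∀ v → Adj v v ≡ false
open SimpleGraph public

-- An E(G)-orientation: to each edge {u,v} assign one of its endpoints (the head).
-- The edge {u,v} may be presented as (u,v) or (v,u); the head must not depend on that.
record Orientation {n : ℕ} (G : SimpleGraph n) : Set where
  field
    head     : (u v : Fin n) → Adj G u v ≡ true → Fin n
    endpoint : ∀ u v (e : Adj G u v ≡ true) → (head u v e ≡ u) ⊎ (head u v e ≡ v)
    wellDef  : ∀ u v (e : Adj G u v ≡ true) (e' : Adj G v u ≡ true) →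
               head u v e ≡ head v u e'
open Orientation public

Arc : {n : ℕ} {G : SimpleGraph n} → Orientation G → Fin n → Fin n → Set
Arc {G = G} σ u v = Σ (Adj G u v ≡ true) λ e → head σ u v e ≡ v

data Walk {n : ℕ} {G : SimpleGraph n} (σ : Orientation G) : Fin n → Fin n → List (Fin n) → Set where
  stop : ∀ {v} → Walk σ v v (v ∷ [])
  step : ∀ {u w t vs} → Arc σ u w → Walk σ w t vs → Walk σ u t (u ∷ vs)

DPath : {n : ℕ} {G : SimpleGraph n} → Orientation G → Fin n → Fin n → List (Fin n) → Set
DPath σ s t vs = Walk σ s t vs × Unique vs

SinglyConnected : {n : ℕ} {G : SimpleGraph n} → Orientation G → Set
SinglyConnected {n} σ = ∀ (s t : Fin n) (p q : List (Fin n)) → DPath σ s t p → DPath σ s t q → p ≡ q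

ScOrientation : {n : ℕ} → SimpleGraph n → Set
ScOrientation G = Σ (Orientation G) SinglyConnected

ScOrientable : {n : ℕ} → SimpleGraph n → Set
ScOrientable G = ScOrientation G

HasLongCycle : {n : ℕ} {G : SimpleGraph n} → Orientation G → Set
HasLongCycle {n} σ = Σ (Fin n) λ u → Σ (Fin n) λ v → Σ (List (Fin n)) λ vs →
  DPath σ u v vs × Arc σ v u × 4 ≤ length vs

{-# OPTIONS --safe #-}
-- Let σ be an sc-orientation with a directed cycle C = a → b → ⋯ → c → d → a of length at least 4,
-- and let σ′ reverse the arcs a → b and c → d. Since σ is singly connected, C has no chords and no
-- σ-path leaves C and comes back to it. Inside C, σ′ only has the arcs b → a, d → a, d → c and the path
-- b → ⋯ → c, so a and c are sinks and two vertices of C are joined by at most one σ′-path. Replacing the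
-- part of a σ′-path that runs in C by the σ-path along C maps σ′-paths injectively to σ-paths with the
-- same ends. Hence σ′ is singly connected and reaches strictly less than σ (a no longer reaches b), so
-- repeating the reversal ends, after at most n² steps, with an sc-orientation without long cycles.

module Submission where

open import Defs hiding (sym)

open import Axiom.UniquenessOfIdentityProofs using (module Decidable⇒UIP)
open import Data.Bool using (true) renaming (_≟_ to _≟ᵇ_)
open import Data.Empty using (⊥; ⊥-elim)
open import Data.Fin using (Fin) renaming (_≟_ to _≟ᶠ_)
open import Data.Fin.Properties using (any?)
open import Data.List using (List; []; _∷_; _++_; [_]; length; map; concatMap; allFin; upTo; cartesianProduct)
open import Data.List.Properties using (++-assoc; ∷-injective; ∷-injectiveˡ; ∷-injectiveʳ; length-++-sucʳ)
open import Data.List.Membership.Propositional using (_∈_; _∉_)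
open import Data.List.Membership.Propositional.Properties
  using (∈-++⁺ˡ; ∈-++⁺ʳ; ∈-++⁻; ∈-∃++; ∈-map⁺; ∈-concatMap⁺; ∈-allFin; ∈-upTo⁺; ∈-cartesianProduct⁺)
open import Data.List.Relation.Binary.Disjoint.Propositional using (Disjoint)
open import Data.List.Relation.Unary.All as All using (All; []; _∷_)
open import Data.List.Relation.Unary.All.Properties using () renaming (++⁻ˡ to All-++⁻ˡ)
open import Data.List.Relation.Unary.AllPairs as AllPairs using ([]; _∷_)
open import Data.List.Relation.Unary.Any as Any using (here; there)
open import Data.List.Relation.Unary.Unique.DecPropositional using (unique?)
open import Data.List.Relation.Unary.Unique.Propositional using (Unique)
open import Data.List.Relation.Unary.Unique.Propositional.Properties as Unique using (Unique[x∷xs]⇒x∉xs)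
open import Data.Nat using (ℕ; zero; suc; _≤_; _<_; z≤n; s≤s; _+_; _≤?_)
open import Data.Nat.Properties using (≤-refl; <⇒≱; +-suc; +-identityʳ)
open import Data.Product as Prod using (Σ; _×_; _,_; proj₁; proj₂)
open import Data.Sum as Sum using (_⊎_; inj₁; inj₂)
open import Function using (_∘′_)
open import Function.Bundles using (_⇔_; mk⇔)
open import Relation.Binary.PropositionalEquality
  using (_≡_; _≢_; refl; sym; trans; cong; cong₂; subst; module ≡-Reasoning)
open import Relation.Nullary using (¬_; Dec; yes; no)
open import Relation.Nullary.Decidable using (_×-dec_; _⊎-dec_)

open ≡-Reasoning

module _ {A : Set} where

  Unique-++⁻ˡ : ∀ (xs : List A) {ys} → Unique (xs ++ ys) → Unique xs
  Unique-++⁻ˡ []       _          = []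
  Unique-++⁻ˡ (x ∷ xs) (px ∷ pxs) = All-++⁻ˡ xs px ∷ Unique-++⁻ˡ xs pxs

  Unique-++⁻ʳ : ∀ (xs : List A) {ys} → Unique (xs ++ ys) → Unique ys
  Unique-++⁻ʳ []       u = u
  Unique-++⁻ʳ (x ∷ xs) u = Unique-++⁻ʳ xs (AllPairs.tail u)

  Unique-++⇒Disjoint : ∀ (xs : List A) {ys} → Unique (xs ++ ys) → Disjoint xs ys
  Unique-++⇒Disjoint (x ∷ xs) u (here refl , v∈ys) = Unique[x∷xs]⇒x∉xs u (∈-++⁺ʳ xs v∈ys)
  Unique-++⇒Disjoint (x ∷ xs) u (there v∈xs , v∈ys) = Unique-++⇒Disjoint xs (AllPairs.tail u) (v∈xs , v∈ys)

  Unique-++-∷⁻ : ∀ (xs : List A) {y ys} → Unique (xs ++ y ∷ ys) → Unique (xs ++ [ y ])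
  Unique-++-∷⁻ xs {y} {ys} u = Unique-++⁻ˡ (xs ++ [ y ]) (subst Unique (sym (++-assoc xs [ y ] ys)) u)

  ∈-++-[]⇒∈-++-∷ : ∀ (xs : List A) {y ys v} → v ∈ xs ++ [ y ] → v ∈ xs ++ y ∷ ys
  ∈-++-[]⇒∈-++-∷ xs v∈ with ∈-++⁻ xs v∈
  ... | inj₁ v∈xs        = ∈-++⁺ˡ v∈xs
  ... | inj₂ (here refl) = ∈-++⁺ʳ xs (here refl)

  ++-[]≢[] : ∀ (xs : List A) y → xs ++ [ y ] ≢ []
  ++-[]≢[] []      y ()
  ++-[]≢[] (_ ∷ _) y ()

  Unique-∷-split-unique : ∀ (xs xs′ : List A) {z ys ys′} → Unique (xs ++ z ∷ ys) →
                          xs ++ z ∷ ys ≡ xs′ ++ z ∷ ys′ → xs ≡ xs′ × ys ≡ ys′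
  Unique-∷-split-unique []       []        u refl = refl , refl
  Unique-∷-split-unique []       (_ ∷ xs′) u refl = ⊥-elim (Unique[x∷xs]⇒x∉xs u (∈-++⁺ʳ xs′ (here refl)))
  Unique-∷-split-unique (_ ∷ xs) []        u refl = ⊥-elim (Unique[x∷xs]⇒x∉xs u (∈-++⁺ʳ xs (here refl)))
  Unique-∷-split-unique (x ∷ xs) (x′ ∷ xs′) u eq with ∷-injective eq
  ... | refl , eq′ with Unique-∷-split-unique xs xs′ (AllPairs.tail u) eq′
  ... | refl , refl = refl , refl

  ++-injective-All-¬All : ∀ {P : A → Set} (xs xs′ ys ys′ : List A) →
                          All P xs → All P xs′ → All (¬_ ∘′ P) ys → All (¬_ ∘′ P) ys′ →
                          xs ++ ys ≡ xs′ ++ ys′ → xs ≡ xs′ × ys ≡ ys′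
  ++-injective-All-¬All []       []        _ _ _          _           _          _ eq   = refl , eq
  ++-injective-All-¬All []       (_ ∷ _)   _ _ _          (px′ ∷ _)   (¬px ∷ _)  _ refl = ⊥-elim (¬px px′)
  ++-injective-All-¬All (_ ∷ _)  []        _ _ (px ∷ _)   _           _  (¬px′ ∷ _) refl = ⊥-elim (¬px′ px)
  ++-injective-All-¬All (x ∷ xs) (x′ ∷ xs′) ys ys′ (_ ∷ pxs) (_ ∷ pxs′) ¬pys ¬pys′ eq with ∷-injective eq
  ... | refl , eq′ with ++-injective-All-¬All xs xs′ ys ys′ pxs pxs′ ¬pys ¬pys′ eq′
  ... | refl , refl = refl , refl

  Unique-⊆⇒length-≤ : ∀ (xs ys : List A) → Unique xs → (∀ {x} → x ∈ xs → x ∈ ys) → length xs ≤ length ys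
  Unique-⊆⇒length-≤ []       ys _ _   = z≤n
  Unique-⊆⇒length-≤ (x ∷ xs) ys u xs⊆ys with ∈-∃++ (xs⊆ys (here refl))
  ... | ys₁ , ys₂ , refl = subst (suc (length xs) ≤_) (sym (length-++-sucʳ ys₁ x ys₂))
                             (s≤s (Unique-⊆⇒length-≤ xs (ys₁ ++ ys₂) (AllPairs.tail u) xs⊆ys₁++ys₂))
    where
    xs⊆ys₁++ys₂ : ∀ {v} → v ∈ xs → v ∈ ys₁ ++ ys₂
    xs⊆ys₁++ys₂ v∈xs with ∈-++⁻ ys₁ (xs⊆ys (there v∈xs))
    ... | inj₁ v∈ys₁          = ∈-++⁺ˡ v∈ys₁
    ... | inj₂ (here refl)    = ⊥-elim (Unique[x∷xs]⇒x∉xs u v∈xs)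
    ... | inj₂ (there v∈ys₂)  = ∈-++⁺ʳ ys₁ v∈ys₂

  head-∈-init : ∀ (xs : List A) {x y z ys} → x ∷ ys ≡ xs ++ y ∷ z ∷ [] → x ∈ xs ++ [ y ]
  head-∈-init []      refl = here refl
  head-∈-init (_ ∷ _) refl = here refl

  split-last-two : ∀ (xs : List A) → 2 ≤ length xs → Σ (List A) λ ys → Σ A λ y → Σ A λ z → xs ≡ ys ++ y ∷ z ∷ []
  split-last-two (_ ∷ [])         (s≤s ())
  split-last-two (x ∷ y ∷ [])     _ = [] , x , y , refl
  split-last-two (x ∷ y ∷ z ∷ xs) _ with split-last-two (y ∷ z ∷ xs) (s≤s (s≤s z≤n))
  ... | ys , y′ , z′ , eq = x ∷ ys , y′ , z′ , cong (x ∷_) eq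

Arc⇒≢ : ∀ {n} {G : SimpleGraph n} {σ : Orientation G} {u v} → Arc σ u v → u ≢ v
Arc⇒≢ {G = G} (e , _) refl with trans (sym e) (irrefl G _)
... | ()

module Walks {n : ℕ} {G : SimpleGraph n} (σ : Orientation G) where

  walk-source : ∀ {s t x xs} → Walk σ s t (x ∷ xs) → x ≡ s
  walk-source stop       = refl
  walk-source (step _ _) = refl

  walk-endpoints-unique : ∀ {s t s′ t′ vs} → Walk σ s t vs → Walk σ s′ t′ vs → s ≡ s′ × t ≡ t′
  walk-endpoints-unique stop        stop          = refl , refl
  walk-endpoints-unique stop        (step _ ())
  walk-endpoints-unique (step _ ()) stop
  walk-endpoints-unique (step _ w)  (step _ w′) with walk-endpoints-unique w w′
  ... | refl , refl = refl , refl

  walk-target∈ : ∀ {s t vs} → Walk σ s t vs → t ∈ vs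
  walk-target∈ stop       = here refl
  walk-target∈ (step _ w) = there (walk-target∈ w)

  walk-uncons : ∀ {s t x y xs} → Walk σ s t (x ∷ y ∷ xs) → Arc σ s y × Walk σ y t (y ∷ xs)
  walk-uncons (step a w) with walk-source w
  ... | refl = a , w

  walk-++ : ∀ {s m t ps qs} → Walk σ s m ps → Walk σ m t (m ∷ qs) → Walk σ s t (ps ++ qs)
  walk-++ stop       w = w
  walk-++ (step a r) w = step a (walk-++ r w)

  walk-++-arc : ∀ {s m m′ t ps qs} → Walk σ s m ps → Arc σ m m′ → Walk σ m′ t qs → Walk σ s t (ps ++ qs)
  walk-++-arc stop       a w = step a w
  walk-++-arc (step a′ r) a w = step a′ (walk-++-arc r a w)

  walk-split : ∀ ps {s t x qs} → Walk σ s t (ps ++ x ∷ qs) → Walk σ s x (ps ++ [ x ]) × Walk σ x t (x ∷ qs)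
  walk-split [] w with walk-source w
  ... | refl = stop , w
  walk-split (p ∷ []) (step a w) with walk-source w
  ... | refl = step a stop , w
  walk-split (p ∷ p′ ∷ ps) (step a w) with walk-split (p′ ∷ ps) w
  ... | w₁ , w₂ = step a w₁ , w₂

  walk-last : ∀ xs {s t z} → Walk σ s t (xs ++ [ z ]) → z ≡ t
  walk-last xs w = sym (proj₂ (walk-endpoints-unique (proj₂ (walk-split xs w)) stop))

  walk-source-All : ∀ {P : Fin n → Set} {s t vs} → Walk σ s t vs → All P vs → P s
  walk-source-All stop       (ps ∷ _) = ps
  walk-source-All (step _ _) (ps ∷ _) = ps

  closed-path-trivial : ∀ {x vs} → Walk σ x x vs → Unique vs → vs ≡ [ x ]
  closed-path-trivial stop       _ = refl
  closed-path-trivial (step _ w) u = ⊥-elim (Unique[x∷xs]⇒x∉xs u (walk-target∈ w))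

  arc-path : ∀ {x y} → Arc σ x y → DPath σ x y (x ∷ y ∷ [])
  arc-path xy = step xy stop , (Arc⇒≢ {σ = σ} xy ∷ []) ∷ [] ∷ []

module ReverseArc {n : ℕ} {G : SimpleGraph n} (σ : Orientation G) (a b : Fin n) (ab : Arc σ a b) where

  OnEdge : Fin n → Fin n → Set
  OnEdge u v = (u ≡ a × v ≡ b) ⊎ (u ≡ b × v ≡ a)

  onEdge? : ∀ u v → Dec (OnEdge u v)
  onEdge? u v = (u ≟ᶠ a ×-dec v ≟ᶠ b) ⊎-dec (u ≟ᶠ b ×-dec v ≟ᶠ a)

  OnEdge-sym : ∀ {u v} → OnEdge u v → OnEdge v u
  OnEdge-sym = Sum.swap ∘′ Sum.map Prod.swap Prod.swap

  reversed-head : (u v : Fin n) → Adj G u v ≡ true → Fin n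
  reversed-head u v e with onEdge? u v
  ... | yes _ = a
  ... | no  _ = head σ u v e

  reversed-endpoint : ∀ u v (e : Adj G u v ≡ true) → reversed-head u v e ≡ u ⊎ reversed-head u v e ≡ v
  reversed-endpoint u v e with onEdge? u v
  ... | yes (inj₁ (refl , refl)) = inj₁ refl
  ... | yes (inj₂ (refl , refl)) = inj₂ refl
  ... | no  _                    = endpoint σ u v e

  reversed-wellDef : ∀ u v (e : Adj G u v ≡ true) (e′ : Adj G v u ≡ true) →
                     reversed-head u v e ≡ reversed-head v u e′
  reversed-wellDef u v e e′ with onEdge? u v | onEdge? v u
  ... | yes _  | yes _  = refl
  ... | yes uv | no ¬vu = ⊥-elim (¬vu (OnEdge-sym uv))
  ... | no ¬uv | yes vu = ⊥-elim (¬uv (OnEdge-sym vu))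
  ... | no _   | no _   = wellDef σ u v e e′

  reversed : Orientation G
  reversed = record { head = reversed-head ; endpoint = reversed-endpoint ; wellDef = reversed-wellDef }

  reversed-arc⁻ : ∀ {u v} → Arc reversed u v → (Arc σ u v × ¬ (u ≡ a × v ≡ b)) ⊎ (u ≡ b × v ≡ a)
  reversed-arc⁻ {u} {v} (e , h) with onEdge? u v
  ... | yes (inj₁ (refl , refl)) = ⊥-elim (Arc⇒≢ {σ = σ} ab h)
  ... | yes (inj₂ uv)            = inj₂ uv
  ... | no ¬uv                   = inj₁ ((e , h) , ¬uv ∘′ inj₁)

  reversed-arc⁺ : ∀ {u v} → Arc σ u v → ¬ (u ≡ a × v ≡ b) → Arc reversed u v
  reversed-arc⁺ {u} {v} (e , h) ¬ab with onEdge? u v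
  ... | yes (inj₁ uv)            = ⊥-elim (¬ab uv)
  ... | yes (inj₂ (refl , refl)) = ⊥-elim (Arc⇒≢ {σ = σ} ab (trans (sym h) (trans (wellDef σ b a e (proj₁ ab)) (proj₂ ab))))
  ... | no _                     = e , h

module Cycle {n : ℕ} {G : SimpleGraph n} (σ : Orientation G)
             {a d : Fin n} {L : List (Fin n)} (cycle : Walk σ a d L) (uniqueL : Unique L) (da : Arc σ d a) where

  open Walks σ

  data AlongCycle (x y : Fin n) : Set where
    same    : x ≡ y → AlongCycle x y
    forward : ∀ p q₁ q₂ → L ≡ p ++ x ∷ q₁ ++ y ∷ q₂ → DPath σ x y (x ∷ q₁ ++ [ y ]) → AlongCycle x y
    wrap    : ∀ p₁ p₂ q → L ≡ (p₁ ++ y ∷ p₂) ++ x ∷ q → DPath σ x y ((x ∷ q) ++ p₁ ++ [ y ]) → AlongCycle x y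

  along-cycle : ∀ {x y} → x ∈ L → y ∈ L → AlongCycle x y
  along-cycle {x} {y} x∈ y∈ with ∈-∃++ x∈
  ... | p , q , refl with ∈-++⁻ p y∈
  ... | inj₂ (here refl) = same refl
  ... | inj₂ (there y∈q) with ∈-∃++ y∈q
  ...   | q₁ , q₂ , refl = forward p q₁ q₂ refl
          (proj₁ (walk-split (x ∷ q₁) (proj₂ (walk-split p cycle))) , Unique-++-∷⁻ (x ∷ q₁) (Unique-++⁻ʳ p uniqueL))
  along-cycle {x} {y} x∈ y∈ | p , q , refl | inj₁ y∈p with ∈-∃++ y∈p
  ... | p₁ , p₂ , refl = wrap p₁ p₂ q refl (walk-++-arc x→d da a→y , unique)
    where
    assoc = ++-assoc p₁ (y ∷ p₂) (x ∷ q)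
    x→d : Walk σ x d (x ∷ q)
    x→d = proj₂ (walk-split (p₁ ++ y ∷ p₂) cycle)
    a→y : Walk σ a y (p₁ ++ [ y ])
    a→y = proj₁ (walk-split p₁ (subst (Walk σ a d) assoc cycle))
    unique : Unique ((x ∷ q) ++ p₁ ++ [ y ])
    unique = Unique.++⁺ (Unique-++⁻ʳ (p₁ ++ y ∷ p₂) uniqueL) (Unique-++-∷⁻ p₁ (subst Unique assoc uniqueL))
               λ (v∈xq , v∈p₁y) → Unique-++⇒Disjoint (p₁ ++ y ∷ p₂) uniqueL (∈-++-[]⇒∈-++-∷ p₁ v∈p₁y , v∈xq)

  module _ (sc : SinglyConnected σ) where

    cycle-path : ∀ {x y} → x ∈ L → y ∈ L → Σ (List (Fin n)) λ P → DPath σ x y P × (∀ {v} → v ∈ P → v ∈ L)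
    cycle-path {x} x∈ y∈ with along-cycle x∈ y∈
    ... | same refl              = [ x ] , (stop , [] ∷ []) , λ { (here refl) → x∈ }
    ... | forward p q₁ _ refl xy = _ , xy , ∈-++⁺ʳ p ∘′ ∈-++-[]⇒∈-++-∷ (x ∷ q₁)
    ... | wrap p₁ p₂ q refl xy   = _ , xy , λ v∈ →
            Sum.[ ∈-++⁺ʳ (p₁ ++ _ ∷ p₂) , ∈-++⁺ˡ ∘′ ∈-++-[]⇒∈-++-∷ p₁ ]′ (∈-++⁻ (x ∷ q) v∈)

    first-step-on-cycle : ∀ {x y w E} → x ∈ L → y ∈ L → DPath σ x y (x ∷ w ∷ E) → w ∈ L
    first-step-on-cycle x∈ y∈ xy with cycle-path x∈ y∈
    ... | P , xy′ , P⊆L with sc _ _ P _ xy′ xy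
    ... | refl = P⊆L (there (here refl))

    cycle-chordless : ∀ {x y} → x ∈ L → y ∈ L → Arc σ x y →
                      (Σ (List (Fin n)) λ pre → Σ (List (Fin n)) λ post → L ≡ pre ++ x ∷ y ∷ post) ⊎ (x ≡ d × y ≡ a)
    cycle-chordless {x} {y} x∈ y∈ xy with along-cycle x∈ y∈
    ... | same refl                      = ⊥-elim (Arc⇒≢ {σ = σ} xy refl)
    ... | forward p [] q₂ refl _         = inj₁ (p , q₂ , refl)
    ... | forward p (_ ∷ q₁) q₂ refl xy′ with sc x y _ _ xy′ (arc-path xy)
    ...   | eq = ⊥-elim (++-[]≢[] q₁ y (∷-injectiveʳ (∷-injectiveʳ eq)))
    cycle-chordless {x} {y} x∈ y∈ xy | wrap [] p₂ [] refl _ = inj₂ (walk-last (y ∷ p₂) cycle , walk-source cycle)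
    cycle-chordless {x} {y} x∈ y∈ xy | wrap (_ ∷ p₁) p₂ [] refl xy′ with sc x y _ _ xy′ (arc-path xy)
    ... | eq = ⊥-elim (++-[]≢[] p₁ y (∷-injectiveʳ (∷-injectiveʳ eq)))
    cycle-chordless {x} {y} x∈ y∈ xy | wrap p₁ p₂ (_ ∷ q) refl xy′ with sc x y _ _ xy′ (arc-path xy)
    ... | eq = ⊥-elim (++-[]≢[] (q ++ p₁) y (trans (++-assoc q p₁ [ y ]) (∷-injectiveʳ (∷-injectiveʳ eq))))

module ReverseTwoArcs {n : ℕ} {G : SimpleGraph n} (σ : Orientation G) (sc : SinglyConnected σ)
  (a b c d : Fin n) (M : List (Fin n))
  (cycle : Walk σ a d (a ∷ b ∷ M ++ c ∷ d ∷ [])) (uniqueC : Unique (a ∷ b ∷ M ++ c ∷ d ∷ [])) (da : Arc σ d a) where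

  open Walks σ
  open Cycle σ cycle uniqueC da

  C : List (Fin n)
  C = a ∷ b ∷ M ++ c ∷ d ∷ []

  Inner : List (Fin n)
  Inner = M ++ [ c ]

  C≡abInner∷d : C ≡ (a ∷ b ∷ Inner) ++ [ d ]
  C≡abInner∷d = cong (λ l → a ∷ b ∷ l) (sym (++-assoc M [ c ] [ d ]))

  a∈C : a ∈ C
  a∈C = here refl
  b∈C : b ∈ C
  b∈C = there (here refl)
  M⊆C : ∀ {x} → x ∈ M → x ∈ C
  M⊆C x∈M = there (there (∈-++⁺ˡ x∈M))
  c∈C : c ∈ C
  c∈C = there (there (∈-++⁺ʳ M (here refl)))
  d∈C : d ∈ C
  d∈C = there (there (∈-++⁺ʳ M (there (here refl))))

  a∉bMcd : a ∉ b ∷ M ++ c ∷ d ∷ []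
  a∉bMcd = Unique[x∷xs]⇒x∉xs uniqueC
  b∉Mcd : b ∉ M ++ c ∷ d ∷ []
  b∉Mcd = Unique[x∷xs]⇒x∉xs (AllPairs.tail uniqueC)

  a≢b : a ≢ b
  a≢b refl = a∉bMcd (here refl)
  a≢c : a ≢ c
  a≢c refl = a∉bMcd (there (∈-++⁺ʳ M (here refl)))
  a≢d : a ≢ d
  a≢d refl = a∉bMcd (there (∈-++⁺ʳ M (there (here refl))))
  a∉Inner : a ∉ Inner
  a∉Inner a∈ = a∉bMcd (there (∈-++-[]⇒∈-++-∷ M a∈))
  b≢c : b ≢ c
  b≢c refl = b∉Mcd (∈-++⁺ʳ M (here refl))
  b≢d : b ≢ d
  b≢d refl = b∉Mcd (∈-++⁺ʳ M (there (here refl)))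
  b∉M : b ∉ M
  b∉M b∈ = b∉Mcd (∈-++⁺ˡ b∈)
  c≢d : c ≢ d
  c≢d refl = Unique[x∷xs]⇒x∉xs (Unique-++⁻ʳ (a ∷ b ∷ M) uniqueC) (here refl)
  d∉M : d ∉ M
  d∉M d∈ = Unique-++⇒Disjoint (a ∷ b ∷ M) uniqueC (there (there d∈) , there (here refl))

  ab : Arc σ a b
  ab = proj₁ (walk-uncons cycle)

  cd : Arc σ c d
  cd = proj₁ (walk-uncons (proj₂ (walk-split (a ∷ b ∷ M) cycle)))

  σ₁ : Orientation G
  σ₁ = ReverseArc.reversed σ a b ab

  cd₁ : Arc σ₁ c d
  cd₁ = ReverseArc.reversed-arc⁺ σ a b ab cd (λ (a≡c , _) → a≢c (sym a≡c))

  σ′ : Orientation G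
  σ′ = ReverseArc.reversed σ₁ c d cd₁

  open Walks σ′ using () renaming (walk-source to walk′-source; walk-target∈ to walk′-target∈;
    walk-split to walk′-split; closed-path-trivial to closed-path′-trivial; walk-source-All to walk′-source-All)

  arc′⁻ : ∀ {u v} → Arc σ′ u v →
          (Arc σ u v × ¬ (u ≡ a × v ≡ b) × ¬ (u ≡ c × v ≡ d)) ⊎ (u ≡ b × v ≡ a) ⊎ (u ≡ d × v ≡ c)
  arc′⁻ uv with ReverseArc.reversed-arc⁻ σ₁ c d cd₁ uv
  ... | inj₂ dc = inj₂ (inj₂ dc)
  ... | inj₁ (uv₁ , ¬cd) with ReverseArc.reversed-arc⁻ σ a b ab uv₁
  ...   | inj₂ ba         = inj₂ (inj₁ ba)
  ...   | inj₁ (uv₀ , ¬ab) = inj₁ (uv₀ , ¬ab , ¬cd)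

  a-sink : ∀ {u} → Arc σ′ a u → u ∉ C
  a-sink au u∈ with arc′⁻ au
  ... | inj₂ (inj₁ (a≡b , _)) = a≢b a≡b
  ... | inj₂ (inj₂ (a≡d , _)) = a≢d a≡d
  ... | inj₁ (au₀ , ¬ab , _) with cycle-chordless sc a∈C u∈ au₀
  ...   | inj₂ (a≡d , _) = a≢d a≡d
  ...   | inj₁ (pre , _ , eq) with Unique-∷-split-unique [] pre uniqueC eq
  ...     | _ , eq′ = ¬ab (refl , sym (∷-injectiveˡ eq′))

  b-successor : ∀ {u} → Arc σ′ b u → u ∈ C → u ≡ a ⊎ Σ (List (Fin n)) λ post → u ∷ post ≡ M ++ c ∷ d ∷ []
  b-successor bu u∈ with arc′⁻ bu
  ... | inj₂ (inj₁ (_ , u≡a)) = inj₁ u≡a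
  ... | inj₂ (inj₂ (b≡d , _)) = ⊥-elim (b≢d b≡d)
  ... | inj₁ (bu₀ , _ , _) with cycle-chordless sc b∈C u∈ bu₀
  ...   | inj₂ (b≡d , _) = ⊥-elim (b≢d b≡d)
  ...   | inj₁ (pre , post , eq) with Unique-∷-split-unique [ a ] pre uniqueC eq
  ...     | _ , eq′ = inj₂ (post , sym eq′)

  M-successor : ∀ {x u} → x ∈ M → Arc σ′ x u → u ∈ C →
                Σ (List (Fin n)) λ pre → Σ (List (Fin n)) λ post → C ≡ pre ++ x ∷ u ∷ post
  M-successor x∈M xu u∈ with arc′⁻ xu
  ... | inj₂ (inj₁ (refl , _)) = ⊥-elim (b∉M x∈M)
  ... | inj₂ (inj₂ (refl , _)) = ⊥-elim (d∉M x∈M)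
  ... | inj₁ (xu₀ , _ , _) with cycle-chordless sc (M⊆C x∈M) u∈ xu₀
  ...   | inj₂ (refl , _) = ⊥-elim (d∉M x∈M)
  ...   | inj₁ split      = split

  c-sink : ∀ {u} → Arc σ′ c u → u ∉ C
  c-sink cu u∈ with arc′⁻ cu
  ... | inj₂ (inj₁ (c≡b , _)) = b≢c (sym c≡b)
  ... | inj₂ (inj₂ (c≡d , _)) = c≢d c≡d
  ... | inj₁ (cu₀ , _ , ¬cd) with cycle-chordless sc c∈C u∈ cu₀
  ...   | inj₂ (c≡d , _) = c≢d c≡d
  ...   | inj₁ (pre , _ , eq) with Unique-∷-split-unique (a ∷ b ∷ M) pre uniqueC eq
  ...     | _ , eq′ = ¬cd (refl , sym (∷-injectiveˡ eq′))

  d-successor : ∀ {u} → Arc σ′ d u → u ∈ C → u ≡ a ⊎ u ≡ c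
  d-successor du u∈ with arc′⁻ du
  ... | inj₂ (inj₁ (d≡b , _)) = ⊥-elim (b≢d (sym d≡b))
  ... | inj₂ (inj₂ (_ , u≡c)) = inj₂ u≡c
  ... | inj₁ (du₀ , _ , _) with cycle-chordless sc d∈C u∈ du₀
  ...   | inj₂ (_ , u≡a) = inj₁ u≡a
  ...   | inj₁ (pre , _ , eq)
          with Unique-∷-split-unique (a ∷ b ∷ Inner) pre (subst Unique C≡abInner∷d uniqueC) (trans (sym C≡abInner∷d) eq)
  ...     | _ , ()

  Inner-successor : ∀ {x u} → x ∈ Inner → Arc σ′ x u → u ∈ C → u ∈ Inner
  Inner-successor {x} {u} x∈ xu u∈ with ∈-++⁻ M x∈
  ... | inj₂ (here refl) = ⊥-elim (c-sink xu u∈)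
  ... | inj₁ x∈M with M-successor x∈M xu u∈ | ∈-∃++ x∈M
  ...   | pre , post , eq | M₁ , M₂ , refl =
          subst (u ∈_) (sym (++-assoc M₁ (x ∷ M₂) [ c ])) (∈-++⁺ʳ M₁ (there (head-∈-init M₂ (sym M₂cd≡))))
    where
    C≡ : C ≡ (a ∷ b ∷ M₁) ++ x ∷ (M₂ ++ c ∷ d ∷ [])
    C≡ = cong (λ l → a ∷ b ∷ l) (++-assoc M₁ (x ∷ M₂) (c ∷ d ∷ []))
    M₂cd≡ : M₂ ++ c ∷ d ∷ [] ≡ u ∷ post
    M₂cd≡ = proj₂ (Unique-∷-split-unique (a ∷ b ∷ M₁) pre (subst Unique C≡ uniqueC) (trans (sym C≡) eq))

  walk′-from-sink : ∀ {x y P} → x ≡ a ⊎ x ≡ c → Walk σ′ x y P → All (_∈ C) P → y ≡ x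
  walk′-from-sink _          stop        _        = refl
  walk′-from-sink (inj₁ refl) (step xu w) (_ ∷ P⊆C) = ⊥-elim (a-sink xu (walk′-source-All w P⊆C))
  walk′-from-sink (inj₂ refl) (step xu w) (_ ∷ P⊆C) = ⊥-elim (c-sink xu (walk′-source-All w P⊆C))

  walk′-within-Inner : ∀ {x y P} → x ∈ Inner → Walk σ′ x y P → All (_∈ C) P → y ∈ Inner
  walk′-within-Inner x∈ stop        _          = x∈
  walk′-within-Inner x∈ (step xu w) (_ ∷ P⊆C) =
    walk′-within-Inner (Inner-successor x∈ xu (walk′-source-All w P⊆C)) w P⊆C

  no-fork-on-cycle : ∀ {x p q y P Q} → x ∈ C → Arc σ′ x p → Arc σ′ x q → p ≢ q →
                     Walk σ′ p y P → All (_∈ C) P → Walk σ′ q y Q → All (_∈ C) Q → ⊥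
  no-fork-on-cycle (here refl) xp _ _ wp P⊆C _ _ = a-sink xp (walk′-source-All wp P⊆C)
  no-fork-on-cycle (there (here refl)) xp xq p≢q wp P⊆C wq Q⊆C
    with b-successor xp (walk′-source-All wp P⊆C) | b-successor xq (walk′-source-All wq Q⊆C)
  ... | inj₁ p≡a        | inj₁ q≡a        = p≢q (trans p≡a (sym q≡a))
  ... | inj₂ (_ , eqp)  | inj₂ (_ , eqq)  = p≢q (∷-injectiveˡ (trans eqp (sym eqq)))
  ... | inj₁ refl       | inj₂ (_ , eqq) with walk′-from-sink (inj₁ refl) wp P⊆C
  ...   | refl = a∉Inner (walk′-within-Inner (head-∈-init M eqq) wq Q⊆C)
  no-fork-on-cycle (there (here refl)) xp xq p≢q wp P⊆C wq Q⊆C | inj₂ (_ , eqp) | inj₁ refl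
    with walk′-from-sink (inj₁ refl) wq Q⊆C
  ... | refl = a∉Inner (walk′-within-Inner (head-∈-init M eqp) wp P⊆C)
  no-fork-on-cycle (there (there x∈)) xp xq p≢q wp P⊆C wq Q⊆C with ∈-++⁻ M x∈
  ... | inj₂ (here refl) = c-sink xp (walk′-source-All wp P⊆C)
  ... | inj₁ x∈M with M-successor x∈M xp (walk′-source-All wp P⊆C) | M-successor x∈M xq (walk′-source-All wq Q⊆C)
  ...   | pre , _ , eqp | pre′ , _ , eqq =
          p≢q (∷-injectiveˡ (proj₂ (Unique-∷-split-unique pre pre′ (subst Unique eqp uniqueC) (trans (sym eqp) eqq))))
  no-fork-on-cycle (there (there x∈)) xp xq p≢q wp P⊆C wq Q⊆C | inj₂ (there (here refl))
    with d-successor xp (walk′-source-All wp P⊆C) | d-successor xq (walk′-source-All wq Q⊆C)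
  ... | inj₁ p≡a | inj₁ q≡a = p≢q (trans p≡a (sym q≡a))
  ... | inj₂ p≡c | inj₂ q≡c = p≢q (trans p≡c (sym q≡c))
  ... | inj₁ refl | inj₂ refl = a≢c (trans (sym (walk′-from-sink (inj₁ refl) wp P⊆C)) (walk′-from-sink (inj₂ refl) wq Q⊆C))
  ... | inj₂ refl | inj₁ refl = a≢c (trans (sym (walk′-from-sink (inj₁ refl) wq Q⊆C)) (walk′-from-sink (inj₂ refl) wp P⊆C))

  paths′-on-cycle-unique : ∀ {x y P Q} → Walk σ′ x y P → Unique P → Walk σ′ x y Q → Unique Q →
                           All (_∈ C) P → All (_∈ C) Q → P ≡ Q
  paths′-on-cycle-unique stop uP wq uQ _ _ = sym (closed-path′-trivial wq uQ)
  paths′-on-cycle-unique wp uP stop uQ _ _ = closed-path′-trivial wp uP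
  paths′-on-cycle-unique (step {w = p} xp wp) uP (step {w = q} xq wq) uQ (x∈ ∷ P⊆C) (_ ∷ Q⊆C) with p ≟ᶠ q
  ... | yes refl = cong (_ ∷_) (paths′-on-cycle-unique wp (AllPairs.tail uP) wq (AllPairs.tail uQ) P⊆C Q⊆C)
  ... | no p≢q   = ⊥-elim (no-fork-on-cycle x∈ xp xq p≢q wp P⊆C wq Q⊆C)

  open import Data.List.Membership.DecPropositional (_≟ᶠ_ {n}) using (_∈?_)

  arc′-off-cycle : ∀ {u v} → Arc σ′ u v → u ∉ C ⊎ v ∉ C → Arc σ u v
  arc′-off-cycle uv off with arc′⁻ uv
  ... | inj₁ (uv₀ , _ , _)       = uv₀
  ... | inj₂ (inj₁ (refl , refl)) = ⊥-elim (Sum.[ (λ b∉ → b∉ b∈C) , (λ a∉ → a∉ a∈C) ]′ off)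
  ... | inj₂ (inj₂ (refl , refl)) = ⊥-elim (Sum.[ (λ d∉ → d∉ d∈C) , (λ c∉ → c∉ c∈C) ]′ off)

  walk′-off-cycle : ∀ {s t vs} → Walk σ′ s t vs → All (_∉ C) vs → Walk σ s t vs
  walk′-off-cycle stop        _          = stop
  walk′-off-cycle (step uv w) (u∉ ∷ vs∉) = step (arc′-off-cycle uv (inj₁ u∉)) (walk′-off-cycle w vs∉)

  walk′-into-cycle : ∀ xs {s t y} → Walk σ′ s t (xs ++ [ y ]) → All (_∉ C) xs → Walk σ s t (xs ++ [ y ])
  walk′-into-cycle []           stop                 _          = stop
  walk′-into-cycle (_ ∷ [])     (step uv stop)       (u∉ ∷ _)   = step (arc′-off-cycle uv (inj₁ u∉)) stop
  walk′-into-cycle (_ ∷ x ∷ xs) (step uv w)          (u∉ ∷ xs∉) = step (arc′-off-cycle uv (inj₁ u∉)) (walk′-into-cycle (x ∷ xs) w xs∉)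

  first-on-cycle : ∀ (vs : List (Fin n)) → All (_∉ C) vs ⊎
                   Σ (List (Fin n)) λ xs → Σ (Fin n) λ y → Σ (List (Fin n)) λ ys →
                     vs ≡ xs ++ y ∷ ys × All (_∉ C) xs × y ∈ C
  first-on-cycle []       = inj₁ []
  first-on-cycle (v ∷ vs) with v ∈? C
  ... | yes v∈ = inj₂ ([] , v , vs , refl , [] , v∈)
  ... | no v∉ with first-on-cycle vs
  ...   | inj₁ vs∉                             = inj₁ (v∉ ∷ vs∉)
  ...   | inj₂ (xs , y , ys , refl , xs∉ , y∈) = inj₂ (v ∷ xs , y , ys , refl , v∉ ∷ xs∉ , y∈)

  -- The σ-path from the exit point back to C would be a second σ-path between two vertices of C.
  left-cycle-for-good : ∀ {s v t vs} → s ∈ C → Arc σ′ s v → v ∉ C → Walk σ′ v t vs → Unique (s ∷ vs) → All (_∉ C) vs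
  left-cycle-for-good {s} {vs = vs} s∈ sv v∉ w u with first-on-cycle vs
  ... | inj₁ vs∉ = vs∉
  ... | inj₂ ([] , y , _ , refl , _ , y∈) with walk′-source w
  ...   | refl = ⊥-elim (v∉ y∈)
  left-cycle-for-good {s} s∈ sv v∉ w u | inj₂ (g ∷ xs , y , _ , refl , xs∉@(g∉ ∷ _) , y∈) =
    ⊥-elim (g∉ (first-step-on-cycle sc s∈ y∈ (s→y , Unique-++-∷⁻ (s ∷ g ∷ xs) u)))
    where
    s→y : Walk σ s y (s ∷ (g ∷ xs) ++ [ y ])
    s→y = step (arc′-off-cycle sv (inj₂ v∉)) (walk′-into-cycle (g ∷ xs) (proj₁ (walk′-split (g ∷ xs) w)) xs∉)

  record ExitSplit (s t : Fin n) (P : List (Fin n)) : Set where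
    field
      onC offC     : List (Fin n)
      exit         : Fin n
      split        : P ≡ onC ++ offC
      onC-walk     : Walk σ′ s exit onC
      onC-unique   : Unique onC
      onC⊆C        : All (_∈ C) onC
      offC∉C       : All (_∉ C) offC
      offC-unique  : Unique offC
      exit-walk    : Walk σ exit t (exit ∷ offC)

  exit-split : ∀ {s t P} → s ∈ C → Walk σ′ s t P → Unique P → ExitSplit s t P
  exit-split {s} s∈ stop u = record
    { onC = [ s ] ; offC = [] ; exit = s ; split = refl ; onC-walk = stop ; onC-unique = [] ∷ []
    ; onC⊆C = s∈ ∷ [] ; offC∉C = [] ; offC-unique = [] ; exit-walk = stop }
  exit-split {s} s∈ (step {w = v} {vs = vs} sv w) u with v ∈? C
  ... | yes v∈ = record
    { onC = s ∷ onC ; offC = offC ; exit = exit ; split = cong (s ∷_) split ; onC-walk = step sv onC-walk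
    ; onC-unique = Unique-++⁻ˡ (s ∷ onC) (subst Unique (cong (s ∷_) split) u) ; onC⊆C = s∈ ∷ onC⊆C
    ; offC∉C = offC∉C ; offC-unique = offC-unique ; exit-walk = exit-walk }
    where open ExitSplit (exit-split v∈ w (AllPairs.tail u))
  ... | no v∉ = record
    { onC = [ s ] ; offC = vs ; exit = s ; split = refl ; onC-walk = stop ; onC-unique = [] ∷ []
    ; onC⊆C = s∈ ∷ [] ; offC∉C = vs∉ ; offC-unique = AllPairs.tail u
    ; exit-walk = step (arc′-off-cycle sv (inj₂ v∉)) (walk′-off-cycle w vs∉) }
    where vs∉ = left-cycle-for-good s∈ sv v∉ w u

  cycle-then-off : ∀ {s y t K vs} → Walk σ s y K → Unique K → (∀ {v} → v ∈ K → v ∈ C) →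
                   Walk σ y t (y ∷ vs) → Unique vs → All (_∉ C) vs → DPath σ s t (K ++ vs)
  cycle-then-off wK uK K⊆C wvs uvs vs∉ =
    walk-++ wK wvs , Unique.++⁺ uK uvs (λ (v∈K , v∈vs) → All.lookup vs∉ v∈vs (K⊆C v∈K))

  record Lift (s t : Fin n) (P : List (Fin n)) : Set where
    field
      path  : List (Fin n)
      dpath : DPath σ s t path
      ⊆P∪C  : ∀ {v} → v ∈ path → v ∈ P ⊎ v ∈ C

  module ViaCycle {s t P} (s∈ : s ∈ C) (E : ExitSplit s t P) where
    open ExitSplit E

    route-to-exit : Σ (List (Fin n)) λ K → DPath σ s exit K × (∀ {v} → v ∈ K → v ∈ C)
    route-to-exit = cycle-path sc s∈ (All.lookup onC⊆C (walk′-target∈ onC-walk))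

    K : List (Fin n)
    K = proj₁ route-to-exit

    K-walk : Walk σ s exit K
    K-walk = proj₁ (proj₁ (proj₂ route-to-exit))

    K⊆C : ∀ {v} → v ∈ K → v ∈ C
    K⊆C = proj₂ (proj₂ route-to-exit)

    dpath : DPath σ s t (K ++ offC)
    dpath = cycle-then-off K-walk (proj₂ (proj₁ (proj₂ route-to-exit))) K⊆C exit-walk offC-unique offC∉C

  lift-on-cycle : ∀ {s t P} → s ∈ C → Walk σ′ s t P → Unique P → Lift s t P
  lift-on-cycle s∈ w u = record
    { path  = K ++ offC
    ; dpath = dpath
    ; ⊆P∪C  = Sum.[ inj₂ ∘′ K⊆C , inj₁ ∘′ subst (_ ∈_) (sym split) ∘′ ∈-++⁺ʳ onC ]′ ∘′ ∈-++⁻ K }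
    where
    E = exit-split s∈ w u
    open ExitSplit E
    open ViaCycle s∈ E

  lift-∷ : ∀ {s v t P} → s ∉ C → Arc σ′ s v → Unique (s ∷ P) → (R : Lift v t P) → DPath σ s t (s ∷ Lift.path R)
  lift-∷ {P = P} s∉ sv u R =
    step (arc′-off-cycle sv (inj₁ s∉)) (proj₁ dpath) ,
    All.tabulate (λ v∈ s≡v → Sum.[ (λ v∈P → Unique[x∷xs]⇒x∉xs u (subst (_∈ P) (sym s≡v) v∈P))
                                 , (λ v∈C → s∉ (subst (_∈ C) (sym s≡v) v∈C)) ]′ (⊆P∪C v∈))
    ∷ proj₂ dpath
    where open Lift R

  lift : ∀ {s t P} → Walk σ′ s t P → Unique P → Lift s t P
  lift {s} w u with s ∈? C
  lift {s} w           u | yes s∈ = lift-on-cycle s∈ w u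
  lift {s} stop        u | no _   = record { path = [ s ] ; dpath = stop , [] ∷ [] ; ⊆P∪C = inj₁ }
  lift {s} (step sv w) u | no s∉  = record
    { path = s ∷ Lift.path R ; dpath = lift-∷ s∉ sv u R
    ; ⊆P∪C = λ { (here refl) → inj₁ (here refl) ; (there v∈) → Sum.map₁ there (Lift.⊆P∪C R v∈) } }
    where R = lift w (AllPairs.tail u)

  module _ {s t P Q} (s∈ : s ∈ C) (E₁ : ExitSplit s t P) (E₂ : ExitSplit s t Q) where
    private
      module E₁ = ExitSplit E₁
      module E₂ = ExitSplit E₂
      module V₁ = ViaCycle s∈ E₁
      module V₂ = ViaCycle s∈ E₂

    exit-splits-agree : P ≡ Q
    exit-splits-agree
      with ++-injective-All-¬All V₁.K V₂.K _ _ (All.tabulate V₁.K⊆C) (All.tabulate V₂.K⊆C) E₁.offC∉C E₂.offC∉C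
             (sc s t _ _ V₁.dpath V₂.dpath)
    ... | K≡ , offC≡ with walk-endpoints-unique V₁.K-walk (subst (Walk σ s E₂.exit) (sym K≡) V₂.K-walk)
    ... | _ , refl = begin
      P                  ≡⟨ E₁.split ⟩
      E₁.onC ++ E₁.offC  ≡⟨ cong₂ _++_ onC≡ offC≡ ⟩
      E₂.onC ++ E₂.offC  ≡⟨ sym E₂.split ⟩
      Q                  ∎
      where
      onC≡ : E₁.onC ≡ E₂.onC
      onC≡ = paths′-on-cycle-unique E₁.onC-walk E₁.onC-unique E₂.onC-walk E₂.onC-unique E₁.onC⊆C E₂.onC⊆C

  paths′-unique : ∀ {s t P Q} → Walk σ′ s t P → Unique P → Walk σ′ s t Q → Unique Q → P ≡ Q
  paths′-unique {s} wP uP wQ uQ with s ∈? C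
  paths′-unique wP          uP wQ          uQ | yes s∈ = exit-splits-agree s∈ (exit-split s∈ wP uP) (exit-split s∈ wQ uQ)
  paths′-unique stop        uP wQ          uQ | no _   = sym (closed-path′-trivial wQ uQ)
  paths′-unique wP          uP stop        uQ | no _   = closed-path′-trivial wP uP
  paths′-unique (step sv wP) uP (step sv′ wQ) uQ | no s∉
    with sc _ _ _ _ (lift-∷ s∉ sv uP (lift wP (AllPairs.tail uP))) (lift-∷ s∉ sv′ uQ (lift wQ (AllPairs.tail uQ)))
  ... | eq with walk-endpoints-unique (proj₁ (Lift.dpath (lift wP (AllPairs.tail uP))))
                  (subst (Walk σ _ _) (sym (∷-injectiveʳ eq)) (proj₁ (Lift.dpath (lift wQ (AllPairs.tail uQ)))))
  ...   | refl , _ = cong (_ ∷_) (paths′-unique wP (AllPairs.tail uP) wQ (AllPairs.tail uQ))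

  singly-connected′ : SinglyConnected σ′
  singly-connected′ s t P Q (wP , uP) (wQ , uQ) = paths′-unique wP uP wQ uQ

  a↛′b : ∀ {P} → ¬ DPath σ′ a b P
  a↛′b {P} (w , u) = b∉P (walk′-target∈ w)
    where
    open ExitSplit (exit-split a∈C w u)
    onC≡[a] : onC ≡ [ a ]
    onC≡[a] = closed-path′-trivial
      (subst (λ z → Walk σ′ a z onC) (walk′-from-sink (inj₁ refl) onC-walk onC⊆C) onC-walk) onC-unique
    b∉P : b ∉ P
    b∉P b∈P with subst (λ l → b ∈ l ++ offC) onC≡[a] (subst (b ∈_) split b∈P)
    ... | here b≡a = a≢b (sym b≡a)
    ... | there b∈ = All.lookup offC∉C b∈ b∈C

module Enumerate (n : ℕ) where

  lists-of-length : ℕ → List (List (Fin n))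
  lists-of-length zero    = [ [] ]
  lists-of-length (suc k) = concatMap (λ x → map (x ∷_) (lists-of-length k)) (allFin n)

  ∈-lists-of-length : ∀ xs → xs ∈ lists-of-length (length xs)
  ∈-lists-of-length []       = here refl
  ∈-lists-of-length (x ∷ xs) =
    ∈-concatMap⁺ (λ x → map (x ∷_) (lists-of-length (length xs)))
      (Any.map (λ { refl → ∈-map⁺ (x ∷_) (∈-lists-of-length xs) }) (∈-allFin x))

  short-lists : List (List (Fin n))
  short-lists = concatMap lists-of-length (upTo (suc (length (allFin n))))

  Unique⇒∈-short-lists : ∀ xs → Unique xs → xs ∈ short-lists
  Unique⇒∈-short-lists xs u = ∈-concatMap⁺ lists-of-length (Any.map (λ { refl → ∈-lists-of-length xs })
    (∈-upTo⁺ (s≤s (Unique-⊆⇒length-≤ xs (allFin n) u (λ {x} _ → ∈-allFin x)))))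

  pairs : List (Fin n × Fin n)
  pairs = cartesianProduct (allFin n) (allFin n)

  ∈-pairs : ∀ (p : Fin n × Fin n) → p ∈ pairs
  ∈-pairs (x , y) = ∈-cartesianProduct⁺ (∈-allFin x) (∈-allFin y)

module Decide {n : ℕ} {G : SimpleGraph n} (σ : Orientation G) where

  open Walks σ
  open Enumerate n

  arc? : ∀ u v → Dec (Arc σ u v)
  arc? u v with Adj G u v ≟ᵇ true
  ... | no ¬e = no (¬e ∘′ proj₁)
  ... | yes e with head σ u v e ≟ᶠ v
  ...   | yes h = yes (e , h)
  ...   | no ¬h = no λ (e′ , h′) → ¬h (subst (λ e″ → head σ u v e″ ≡ v) (Decidable⇒UIP.≡-irrelevant _≟ᵇ_ e′ e) h′)

  walk? : ∀ s t vs → Dec (Walk σ s t vs)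
  walk? s t []           = no λ ()
  walk? s t (x ∷ []) with x ≟ᶠ s | s ≟ᶠ t
  ... | yes refl | yes refl = yes stop
  ... | no x≢s   | _        = no (x≢s ∘′ walk-source)
  ... | yes refl | no s≢t   = no λ { stop → s≢t refl }
  walk? s t (x ∷ y ∷ ys) with x ≟ᶠ s | arc? s y | walk? y t (y ∷ ys)
  ... | yes refl | yes sy | yes w  = yes (step sy w)
  ... | no x≢s   | _      | _      = no (x≢s ∘′ walk-source)
  ... | yes refl | no ¬sy | _      = no (¬sy ∘′ proj₁ ∘′ walk-uncons)
  ... | yes refl | yes _  | no ¬w  = no (¬w ∘′ proj₂ ∘′ walk-uncons)

  LongCycle : Fin n → Fin n → List (Fin n) → Set
  LongCycle u v vs = DPath σ u v vs × Arc σ v u × 4 ≤ length vs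

  longCycle? : ∀ u v vs → Dec (LongCycle u v vs)
  longCycle? u v vs = (walk? u v vs ×-dec unique? _≟ᶠ_ vs) ×-dec (arc? v u ×-dec (4 ≤? length vs))

  hasLongCycle? : Dec (HasLongCycle σ)
  hasLongCycle? = any? λ u → any? λ v → longCycle-from? u v
    where
    longCycle-from? : ∀ u v → Dec (Σ (List (Fin n)) (LongCycle u v))
    longCycle-from? u v with Any.any? (longCycle? u v) short-lists
    ... | yes found = yes (Any.satisfied found)
    ... | no ¬found = no λ (vs , cyc) →
            ¬found (Any.map (λ { refl → cyc }) (Unique⇒∈-short-lists vs (proj₂ (proj₁ cyc))))

Reach : ∀ {n} {G : SimpleGraph n} → Orientation G → Fin n → Fin n → Set
Reach {n} σ s t = Σ (List (Fin n)) (DPath σ s t)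

record Improvement {n : ℕ} {G : SimpleGraph n} (σ : Orientation G) : Set where
  field
    σ′               : Orientation G
    singly-connected : SinglyConnected σ′
    reach-⊆          : ∀ {s t} → Reach σ′ s t → Reach σ s t
    lost             : Fin n × Fin n
    lost-reach       : Reach σ (proj₁ lost) (proj₂ lost)
    lost-unreachable : ¬ Reach σ′ (proj₁ lost) (proj₂ lost)

module _ {n : ℕ} {G : SimpleGraph n} {σ : Orientation G} (sc : SinglyConnected σ) where

  open Walks σ

  improve : HasLongCycle σ → Improvement σ
  improve (u , v , x₀ ∷ x₁ ∷ xs , (w , uq) , vu , s≤s (s≤s 2≤len)) with split-last-two xs 2≤len | walk-source w
  ... | M , c , d , refl | refl with walk-endpoints-unique (proj₂ (walk-uncons (proj₂ (walk-split (u ∷ x₁ ∷ M) w)))) stop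
  ... | _ , refl = record
    { σ′               = σ′
    ; singly-connected = singly-connected′
    ; reach-⊆          = λ (P , (wP , uP)) → Lift.path (lift wP uP) , Lift.dpath (lift wP uP)
    ; lost             = u , x₁
    ; lost-reach       = _ , arc-path ab
    ; lost-unreachable = λ (_ , ab′) → a↛′b ab′ }
    where open ReverseTwoArcs σ sc u x₁ c d M w uq vu

module _ {n : ℕ} (G : SimpleGraph n) where

  open Enumerate n

  Unreachable : Orientation G → Fin n × Fin n → Set
  Unreachable σ (s , t) = ¬ Reach σ s t

  -- The pairs in W are unreachable and each improvement adds a new one, so |pairs| + 1 rounds suffice.
  eliminate-long-cycles : ∀ (fuel : ℕ) (σ : Orientation G) → SinglyConnected σ →
                          (W : List (Fin n × Fin n)) → Unique W → All (Unreachable σ) W →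
                          length pairs < length W + fuel →
                          Σ (Orientation G) (λ σ → SinglyConnected σ × ¬ HasLongCycle σ)
  eliminate-long-cycles zero σ sc W uW _ pairs<W =
    ⊥-elim (<⇒≱ (subst (length pairs <_) (+-identityʳ _) pairs<W) (Unique-⊆⇒length-≤ W pairs uW (λ {p} _ → ∈-pairs p)))
  eliminate-long-cycles (suc fuel) σ sc W uW W↛ pairs<W with Decide.hasLongCycle? σ
  ... | no ¬long = σ , sc , ¬long
  ... | yes long = eliminate-long-cycles fuel σ′ singly-connected (lost ∷ W) (lost∉W ∷ uW)
                     (lost-unreachable ∷ All.map (_∘′ reach-⊆) W↛) (subst (length pairs <_) (+-suc (length W) fuel) pairs<W)
    where
    open Improvement (improve sc long)
    lost∉W : All (lost ≢_) W
    lost∉W = All.tabulate λ p∈W lost≡p → All.lookup W↛ p∈W (subst (λ p → Reach σ (proj₁ p) (proj₂ p)) lost≡p lost-reach)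

lemma1 : (n : ℕ) (G : SimpleGraph n) →
    ScOrientable G ⇔ Σ (Orientation G) (λ σ → SinglyConnected σ × ¬ HasLongCycle σ)
lemma1 n G = mk⇔ (λ (σ , sc) → eliminate-long-cycles G (suc (length (Enumerate.pairs n))) σ sc [] [] [] ≤-refl)
                 (λ (σ , sc , _) → σ , sc)
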